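{- Let $\mathcal{P}=(T_1,\dots,T_k)$ be a profile of rooted trees, let $\pi=(\pi_1,\dots,\pi_k)$ be a position of $\mathcal{P}$, and let $(S,\Gamma)$ and $(S',\Gamma')$ be two good partitions of $\mathrm{Ch}_{\mathcal{P}}(\pi)$. Define $(S'',\Gamma'')=(S,\Gamma)\sqcap(S',\Gamma')$, i.e. $S''=S\cup S'$ and $\Gamma''=\{A\cap B : A\in\Gamma,\ B\in\Gamma'\}\setminus\{\emptyset\}$. Then $(S'',\Gamma'')$ is also a good partition of $\mathrm{Ch}_{\mathcal{P}}(\pi)$.
   Context: A profile $\mathcal{P}=(T_1,\dots,T_k)$ consists of rooted trees, where $T_i$ has label set $X_i$ and each node of $T_i$ is identified with its (distinct) label. For $a\in X_i$, $\mathrm{Ch}_{T_i}(a)$ is the set of children of $a$ in $T_i$ and $X_i(a)$ is the set of labels in the subtree of $T_i$ rooted at $a$. For a label $\ell$, $\mathrm{Ch}_{\mathcal{P}}(\ell)=\bigcup_{i:\ \ell\in X_i}\mathrm{Ch}_{T_i}(\ell)$. A position is a tuple $\pi=(\pi_1,\dots,\pi_k)$ with $\pi_i\subseteq X_i$; write $\mathrm{Ch}_{T_i}(\pi_i)=\bigcup_{\ell\in\pi_i}\mathrm{Ch}_{T_i}(\ell)$, $\mathrm{Ch}_{\mathcal{P}}(\pi)=\bigcup_{i\in[k]}\mathrm{Ch}_{T_i}(\pi_i)$, and $X_{\mathcal{P}}(\pi)=\bigcup_{i\in[k]}\bigcup_{a\in\pi_i}X_i(a)$. For $A\subseteq \mathrm{Ch}_{\mathcal{P}}(\pi)$,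 $\pi^A$ is the position with $\pi^A_i=A\cap \mathrm{Ch}_{T_i}(\pi_i)$ for each $i$. A partition of $\mathrm{Ch}_{\mathcal{P}}(\pi)$ is a pair $(S,\Gamma)$ with $S\subseteq\bigcup_{i\in[k]}\pi_i$ and $\Gamma$ a partition of $\mathrm{Ch}_{\mathcal{P}}(\pi)$ into nonempty sets. A set $A\in\Gamma$ is nice with respect to $S$ if for every $\ell\in\bigcup_{i\in[k]}\pi_i$ with $\mathrm{Ch}_{\mathcal{P}}(\ell)\cap A\neq\emptyset$: (N1) if $\ell\in S$, then for each $i$ with $\ell\in\pi_i$, $|\mathrm{Ch}_{T_i}(\ell)\cap A|\le 1$ (i.e., the children of $\ell$ in $T_i$ lie in distinct sets of $\Gamma$); (N2) if $\ell\notin S$, then $\mathrm{Ch}_{\mathcal{P}}(\ell)\subseteq A$. The partition $(S,\Gamma)$ is good if every $A\in\Gamma$ is nice with respect to $S$ and $X_{\mathcal{P}}(\pi^A)\cap X_{\mathcal{P}}(\pi^B)=\emptyset$ for all distinct $A,B\in\Gamma$. -}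

module Defs where

open import Level using (0ℓ)
open import Data.Nat using (ℕ)
open import Data.Fin using (Fin)
open import Data.List using (List)
open import Data.List.Membership.Propositional using (_∈_)
open import Data.List.Relation.Unary.Any using (Any)
open import Data.Product using (Σ; ∃; _×_; _,_)
open import Data.Sum using (_⊎_)
open import Data.Empty using (⊥)
open import Relation.Nullary using (¬_)
open import Relation.Binary.PropositionalEquality using (_≡_)

-- Subsets of labels are predicates; sets of subsets are predicates on predicates.
Sub : Set → Set₁
Sub L = L → Set

_≐_ : {L : Set} → Sub L → Sub L → Set
A ≐ B = (∀ x → A x → B x) × (∀ x → B x → A x)

data Tree (L : Set) : Set where
  node : L → List (Tree L) → Tree L

root : {L : Set} → Tree L → L
root (node a _) = a

data _⊑_ {L : Set} : Tree L → Tree L → Set where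
  here  : ∀ {t} → t ⊑ t
  there : ∀ {s u a ts} → u ∈ ts → s ⊑ u → s ⊑ node a ts

Labels : {L : Set} → Tree L → Sub L
Labels t x = Σ _ λ s → s ⊑ t × root s ≡ x

-- every node is identified with its (distinct) label
DistinctLabels : {L : Set} → Tree L → Set
DistinctLabels t = ∀ s s' → s ⊑ t → s' ⊑ t → root s ≡ root s' → s ≡ s'

Ch : {L : Set} → Tree L → L → Sub L
Ch T a c = Σ _ λ ts → node a ts ⊑ T × Any (λ u → root u ≡ c) ts

Xsub : {L : Set} → Tree L → L → Sub L
Xsub T a x = Σ _ λ ts → node a ts ⊑ T × Labels (node a ts) x

record Profile (L : Set) (k : ℕ) : Set where
  field
    tree     : Fin k → Tree L
    distinct : ∀ i → DistinctLabels (tree i)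

module _ {L : Set} {k : ℕ} (P : Profile L k) where
  open Profile P

  IsPosition : (Fin k → Sub L) → Set
  IsPosition π = ∀ i x → π i x → Labels (tree i) x

  ChTπ : (Fin k → Sub L) → Fin k → Sub L
  ChTπ π i c = Σ L λ a → π i a × Ch (tree i) a c

  ChPπ : (Fin k → Sub L) → Sub L
  ChPπ π c = Σ (Fin k) λ i → ChTπ π i c

  ChPℓ : L → Sub L
  ChPℓ ℓ c = Σ (Fin k) λ i → Labels (tree i) ℓ × Ch (tree i) ℓ c

  XP : (Fin k → Sub L) → Sub L
  XP π x = Σ (Fin k) λ i → Σ L λ a → π i a × Xsub (tree i) a x

  restrict : (Fin k → Sub L) → Sub L → (Fin k → Sub L)
  restrict π A i c = A c × ChTπ π i c

  Uπ : (Fin k → Sub L) → Sub L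
  Uπ π ℓ = Σ (Fin k) λ i → π i ℓ

  IsSetPartition : Sub L → (Sub L → Set₁) → Set₁
  IsSetPartition C Γ =
      (∀ A → Γ A → Σ L A)
    × (∀ A → Γ A → ∀ x → A x → C x)
    × (∀ x → C x → Σ (Sub L) λ A → Γ A × A x)
    × (∀ A B → Γ A → Γ B → ∀ x → A x → B x → A ≐ B)

  IsPartitionOfCh : (Fin k → Sub L) → Sub L → (Sub L → Set₁) → Set₁
  IsPartitionOfCh π S Γ =
      (∀ ℓ → S ℓ → Uπ π ℓ)
    × IsSetPartition (ChPπ π) Γ

  Nice : (Fin k → Sub L) → Sub L → Sub L → Set
  Nice π S A = ∀ ℓ → Uπ π ℓ → (Σ L λ c → ChPℓ ℓ c × A c) →
      (S ℓ → ∀ i → π i ℓ → ∀ c d →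
         Ch (tree i) ℓ c → A c → Ch (tree i) ℓ d → A d → c ≡ d)
    × (¬ S ℓ → ∀ c → ChPℓ ℓ c → A c)

  IsGoodPartition : (Fin k → Sub L) → Sub L → (Sub L → Set₁) → Set₁
  IsGoodPartition π S Γ =
      IsPartitionOfCh π S Γ
    × (∀ A → Γ A → Nice π S A)
    × (∀ A B → Γ A → Γ B → ¬ (A ≐ B) →
         ∀ x → XP (restrict π A) x → XP (restrict π B) x → ⊥)

meetS : {L : Set} → Sub L → Sub L → Sub L
meetS S S' ℓ = S ℓ ⊎ S' ℓ

meetΓ : {L : Set} → (Sub L → Set₁) → (Sub L → Set₁) → Sub L → Set₁
meetΓ {L} Γ Γ' Z = Σ (Sub L) λ A → Σ (Sub L) λ B →
  Γ A × Γ' B × (Z ≐ (λ x → A x × B x)) × Σ L Z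

module Submission where

-- Every block Z of the meet is (extensionally) A ∩ B for blocks A ∈ Γ and
-- B ∈ Γ', so each of the three conditions of goodness is inherited blockwise:
--   * partition: the meet of two set partitions of the same set C is again a
--     set partition of C (cover by A_x ∩ B_x, two blocks meeting in x agree in
--     both coordinates, hence coincide);
--   * niceness: (N1) for ℓ ∈ S or ℓ ∈ S' is inherited from A resp. B because
--     Z ⊆ A and Z ⊆ B; (N2) for ℓ ∉ S ∪ S' holds since Ch_P(ℓ) lies in both A
--     and B, hence in Z;
--   * separation: X_P(π^Z) is monotone in Z; if two distinct blocks of the
--     meet shared a label, their Γ-blocks would share it and so coincide, then
--     their Γ'-blocks would share it and coincide, making the blocks equal.

open import Defs
open import Data.Nat using (ℕ)
open import Data.Fin using (Fin)
open import Data.Product using (Σ; _×_; _,_; proj₁; proj₂)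
open import Data.Sum using (inj₁; inj₂)
open import Data.Empty using (⊥)
open import Relation.Nullary using (¬_)
open import Relation.Binary.PropositionalEquality using (_≡_)

_∩_ : {L : Set} → Sub L → Sub L → Sub L
(A ∩ B) x = A x × B x

_⊆_ : {L : Set} → Sub L → Sub L → Set
A ⊆ B = ∀ x → A x → B x

≐-refl : {L : Set} {A : Sub L} → A ≐ A
≐-refl = (λ _ a → a) , (λ _ a → a)

≐-sym : {L : Set} {A B : Sub L} → A ≐ B → B ≐ A
≐-sym (f , g) = g , f

≐-trans : {L : Set} {A B C : Sub L} → A ≐ B → B ≐ C → A ≐ C
≐-trans (f , g) (f' , g') = (λ x a → f' x (f x a)) , (λ x c → g x (g' x c))

∩-cong : {L : Set} {A A' B B' : Sub L} → A ≐ A' → B ≐ B' → (A ∩ B) ≐ (A' ∩ B')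
∩-cong (f , g) (f' , g') =
  (λ x ab → f x (proj₁ ab) , f' x (proj₂ ab)) ,
  (λ x ab → g x (proj₁ ab) , g' x (proj₂ ab))

module MeetBlock {L : Set} {Z A B : Sub L} (Z≐A∩B : Z ≐ (A ∩ B)) where

  ⊆-left : Z ⊆ A
  ⊆-left x z = proj₁ (proj₁ Z≐A∩B x z)

  ⊆-right : Z ⊆ B
  ⊆-right x z = proj₂ (proj₁ Z≐A∩B x z)

  ∩-⊆ : (A ∩ B) ⊆ Z
  ∩-⊆ = proj₂ Z≐A∩B

meet-block-≐ : {L : Set} {Z₁ Z₂ A₁ A₂ B₁ B₂ : Sub L} →
  Z₁ ≐ (A₁ ∩ B₁) → Z₂ ≐ (A₂ ∩ B₂) → A₁ ≐ A₂ → B₁ ≐ B₂ → Z₁ ≐ Z₂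
meet-block-≐ e₁ e₂ eA eB = ≐-trans e₁ (≐-trans (∩-cong eA eB) (≐-sym e₂))

module _ {L : Set} {k : ℕ} (P : Profile L k) where
  open Profile P

  meet-IsSetPartition : {C : Sub L} {Γ Γ' : Sub L → Set₁} →
    IsSetPartition P C Γ → IsSetPartition P C Γ' →
    IsSetPartition P C (meetΓ Γ Γ')
  meet-IsSetPartition {C} {Γ} {Γ'}
    (_ , sub , cov , dis) (_ , _ , cov' , dis') =
    nonempty , inside , covers , disjoint
    where
    nonempty : ∀ Z → meetΓ Γ Γ' Z → Σ L Z
    nonempty Z (_ , _ , _ , _ , _ , z) = z

    inside : ∀ Z → meetΓ Γ Γ' Z → ∀ x → Z x → C x
    inside Z (A , _ , A∈Γ , _ , e , _) x z = sub A A∈Γ x (MeetBlock.⊆-left e x z)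

    covers : ∀ x → C x → Σ (Sub L) λ Z → meetΓ Γ Γ' Z × Z x
    covers x cx with cov x cx | cov' x cx
    ... | A , A∈Γ , ax | B , B∈Γ' , bx =
      (A ∩ B) , (A , B , A∈Γ , B∈Γ' , ≐-refl , x , ax , bx) , ax , bx

    disjoint : ∀ Z₁ Z₂ → meetΓ Γ Γ' Z₁ → meetΓ Γ Γ' Z₂ →
               ∀ x → Z₁ x → Z₂ x → Z₁ ≐ Z₂
    disjoint Z₁ Z₂ (A₁ , B₁ , A₁∈Γ , B₁∈Γ' , e₁ , _)
                   (A₂ , B₂ , A₂∈Γ , B₂∈Γ' , e₂ , _) x z₁ z₂ =
      meet-block-≐ e₁ e₂
        (dis A₁ A₂ A₁∈Γ A₂∈Γ x (⊆-left e₁ x z₁) (⊆-left e₂ x z₂))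
        (dis' B₁ B₂ B₁∈Γ' B₂∈Γ' x (⊆-right e₁ x z₁) (⊆-right e₂ x z₂))
      where open MeetBlock

  module _ (π : Fin k → Sub L) where

    meet-Nice : {S S' A B Z : Sub L} → Z ≐ (A ∩ B) →
      Nice P π S A → Nice P π S' B → Nice P π (meetS S S') Z
    meet-Nice {S} {S'} {A} {B} {Z} e niceA niceB ℓ ℓ∈π (c , c∈Chℓ , zc) =
      separated , absorbed
      where
      open MeetBlock e
      nA = niceA ℓ ℓ∈π (c , c∈Chℓ , ⊆-left c zc)
      nB = niceB ℓ ℓ∈π (c , c∈Chℓ , ⊆-right c zc)

      separated : meetS S S' ℓ → ∀ i → π i ℓ → ∀ c d →
        Ch (tree i) ℓ c → Z c → Ch (tree i) ℓ d → Z d → c ≡ d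
      separated (inj₁ s) i ℓ∈πi c d cc zc dd zd =
        proj₁ nA s i ℓ∈πi c d cc (⊆-left c zc) dd (⊆-left d zd)
      separated (inj₂ s) i ℓ∈πi c d cc zc dd zd =
        proj₁ nB s i ℓ∈πi c d cc (⊆-right c zc) dd (⊆-right d zd)

      -- (N2): ℓ ∉ S ∪ S' means ℓ ∉ S and ℓ ∉ S', so Ch_P(ℓ) ⊆ A ∩ B.
      absorbed : ¬ meetS S S' ℓ → ∀ c → ChPℓ P ℓ c → Z c
      absorbed ℓ∉ c ch = ∩-⊆ c ( proj₂ nA (λ s → ℓ∉ (inj₁ s)) c ch
                               , proj₂ nB (λ s → ℓ∉ (inj₂ s)) c ch )

    XP-restrict-mono : {Z A : Sub L} → Z ⊆ A →
      XP P (restrict P π Z) ⊆ XP P (restrict P π A)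
    XP-restrict-mono Z⊆A x (i , a , (za , ch) , xs) = i , a , (Z⊆A a za , ch) , xs

    meet-separated : {Γ Γ' : Sub L → Set₁} →
      (∀ A B → Γ A → Γ B → ¬ (A ≐ B) →
         ∀ x → XP P (restrict P π A) x → XP P (restrict P π B) x → ⊥) →
      (∀ A B → Γ' A → Γ' B → ¬ (A ≐ B) →
         ∀ x → XP P (restrict P π A) x → XP P (restrict P π B) x → ⊥) →
      ∀ Z₁ Z₂ → meetΓ Γ Γ' Z₁ → meetΓ Γ Γ' Z₂ → ¬ (Z₁ ≐ Z₂) →
      ∀ x → XP P (restrict P π Z₁) x → XP P (restrict P π Z₂) x → ⊥
    meet-separated sep sep' Z₁ Z₂ (A₁ , B₁ , A₁∈Γ , B₁∈Γ' , e₁ , _)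
                                  (A₂ , B₂ , A₂∈Γ , B₂∈Γ' , e₂ , _) Z₁≠Z₂ x x₁ x₂ =
      sep A₁ A₂ A₁∈Γ A₂∈Γ A₁≠A₂ x
        (XP-restrict-mono (⊆-left e₁) x x₁) (XP-restrict-mono (⊆-left e₂) x x₂)
      where
      open MeetBlock

      -- If the Γ-blocks agreed, the Γ'-blocks would have to differ, yet they
      -- share the label x.
      A₁≠A₂ : ¬ (A₁ ≐ A₂)
      A₁≠A₂ eA = sep' B₁ B₂ B₁∈Γ' B₂∈Γ' (λ eB → Z₁≠Z₂ (meet-block-≐ e₁ e₂ eA eB)) x
        (XP-restrict-mono (⊆-right e₁) x x₁) (XP-restrict-mono (⊆-right e₂) x x₂)

mainTheorem1 : {L : Set} {k : ℕ} (P : Profile L k) (π : Fin k → Sub L) →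
    IsPosition P π →
    (S S' : Sub L) (Γ Γ' : Sub L → Set₁) →
    IsGoodPartition P π S Γ → IsGoodPartition P π S' Γ' →
    IsGoodPartition P π (meetS S S') (meetΓ Γ Γ')
mainTheorem1 P π _ S S' Γ Γ'
  ((S⊆π , part) , nice , sep) ((S'⊆π , part') , nice' , sep') =
  (S∪S'⊆π , meet-IsSetPartition P part part') ,
  (λ { Z (A , B , A∈Γ , B∈Γ' , e , _) →
         meet-Nice P π e (nice A A∈Γ) (nice' B B∈Γ') }) ,
  meet-separated P π sep sep'
  where
  S∪S'⊆π : ∀ ℓ → meetS S S' ℓ → Uπ P π ℓ
  S∪S'⊆π ℓ (inj₁ s) = S⊆π ℓ s
  S∪S'⊆π ℓ (inj₂ s) = S'⊆π ℓ s
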